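{- Let $R : X \leftrightarrow Y$ and $S : Y \leftrightarrow Z$ be relations. Then (1) $\Lambda(RS) = \Lambda(R) \ast \Lambda(S)$ and $\Lambda(\mathit{Id}_X) = 1_X$; (2) $\eta(RS) = \eta(R) \ast \eta(S)$ and $\eta(\mathit{Id}_X) = 1_X$; (3) for multirelations $R : X \leftrightarrow \mathcal{P} Y$ and $S : Y \leftrightarrow \mathcal{P} Z$ that are both inner deterministic or both outer deterministic, $\alpha(R \ast S) = \alpha(R)\alpha(S)$, and $\alpha(1_X) = \mathit{Id}_X$.
   Context: Relations $R : X \leftrightarrow Y$ are subsets of $X \times Y$, with relational composition $RS = \{(a,c) \mid \exists b.\ (a,b)\in R \wedge (b,c)\in S\}$ and identity $\mathit{Id}_X$. Multirelations $X \leftrightarrow \mathcal{P} Y$ are subsets of $X \times \mathcal{P} Y$; outer deterministic means graph of a function $X \to \mathcal{P} Y$; inner deterministic means every $B$ with $(a,B)$ in it is a singleton. $\Lambda(R) = \{(a,R(a)) \mid a\in X\}$ with $R(a) = \{b \mid (a,b)\in R\}$; $\eta(R) = \{(a,\{b\}) \mid (a,b)\in R\}$; $\alpha(R) = \{(a,b) \mid \exists B.\ (a,B)\in R \wedge b\in B\}$. $1_X = \{(a,\{a\}) \mid a\in X\}$. Peleg composition: $R \ast S = \{(a,C) \mid \exists B.\ (a,B) \in R \wedge \exists f : Y \to \mathcal{P} Z.\ (\forall b \in B.\ (b,f(b)) \in S) \wedge C = \bigcup_{b \in B} f(b)\}$. -}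

module Defs where

open import Level using (Level; Lift; _⊔_) renaming (suc to lsuc; zero to lzero)
open import Data.Product using (Σ; ∃; _×_; _,_)
open import Function.Bundles using (_⇔_)
open import Relation.Binary.PropositionalEquality using (_≡_)

𝒫 : Set → Set₁
𝒫 Y = Y → Set

_≐_ : {Y : Set} → 𝒫 Y → 𝒫 Y → Set
B ≐ C = ∀ y → B y ⇔ C y

｛_｝ : {Y : Set} → Y → 𝒫 Y
｛ b ｝ = λ y → y ≡ b

Rel : Set → Set → (ℓ : Level) → Set (lsuc ℓ)
Rel X Y ℓ = X → Y → Set ℓ

_⨾_ : {X Y Z : Set} {ℓ : Level} → Rel X Y ℓ → Rel Y Z ℓ → Rel X Z ℓ
(R ⨾ S) a c = ∃ λ b → R a b × S b c

Id : (X : Set) → Rel X X lzero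
Id X a b = a ≡ b

_≡ᴿ_ : {X Y : Set} {ℓ₁ ℓ₂ : Level} → Rel X Y ℓ₁ → Rel X Y ℓ₂ → Set (ℓ₁ ⊔ ℓ₂)
R ≡ᴿ S = ∀ a b → R a b ⇔ S a b

MRel : Set → Set → Set₂
MRel X Y = X → 𝒫 Y → Set₁

_≡ᴹ_ : {X Y : Set} → MRel X Y → MRel X Y → Set₁
R ≡ᴹ S = ∀ a C → R a C ⇔ S a C

Λ : {X Y : Set} → Rel X Y lzero → MRel X Y
Λ R a B = Lift (lsuc lzero) (B ≐ (λ b → R a b))

η : {X Y : Set} → Rel X Y lzero → MRel X Y
η R a B = Lift (lsuc lzero) (∃ λ b → R a b × (B ≐ ｛ b ｝))

α : {X Y : Set} → MRel X Y → Rel X Y (lsuc lzero)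
α R a b = Σ (𝒫 _) λ B → R a B × B b

𝟙 : (X : Set) → MRel X X
𝟙 X a B = Lift (lsuc lzero) (B ≐ ｛ a ｝)

_∗_ : {X Y Z : Set} → MRel X Y → MRel Y Z → MRel X Z
_∗_ {Y = Y} {Z = Z} R S a C =
  Σ (𝒫 Y) λ B → R a B ×
    Σ (Y → 𝒫 Z) λ f → (∀ b → B b → S b (f b)) ×
      (C ≐ (λ c → ∃ λ b → B b × f b c))

InnerDet : {X Y : Set} → MRel X Y → Set₁
InnerDet {Y = Y} R = ∀ a B → R a B → ∃ λ (b : Y) → B ≐ ｛ b ｝

OuterDet : {X Y : Set} → MRel X Y → Set₁
OuterDet {X = X} {Y = Y} R =
  Σ (X → 𝒫 Y) λ f → ∀ a B → R a B ⇔ (B ≐ f a)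

{-# OPTIONS --safe #-}

-- The Peleg composite R ∗ S joins, over a set B with (a, B) ∈ R, chosen
-- images f b ∈ S(b) into ⋃_{b ∈ B} f b. For Λ R the only choices are B = R(a)
-- and f = S, so the union is the relational image of a under R ⨾ S; for η R
-- the set B is a singleton, so the union is a single f b. For α, the inclusion
-- α (R ∗ S) ⊆ α R ⨾ α S always holds; conversely, given b ∈ B with (b, D) ∈ S,
-- we need images for all of B at once. If B is a singleton (R inner
-- deterministic) take f constantly D; if S is the graph of a function g
-- (S outer deterministic) take f = g.
module Submission where

open import Defs
open import Data.Product using (_×_; _,_; ∃)
open import Data.Sum using (_⊎_; [_,_])
open import Level using (Level; lift; lower)
open import Function.Bundles using (mk⇔; Equivalence)
open import Function.Construct.Identity using (⇔-id)
open import Function.Construct.Symmetry using (⇔-sym)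
open import Function.Construct.Composition using (_⇔-∘_)
open import Relation.Binary.Core using (_⇒_)
open import Relation.Binary.PropositionalEquality using (_≡_; refl; sym; trans; subst)

open Equivalence using (to; from)

module _ {Y : Set} where

  ≐-refl : {B : 𝒫 Y} → B ≐ B
  ≐-refl y = ⇔-id _

  ≐-sym : {B C : 𝒫 Y} → B ≐ C → C ≐ B
  ≐-sym e y = ⇔-sym (e y)

  ≐-trans : {B C D : 𝒫 Y} → B ≐ C → C ≐ D → B ≐ D
  ≐-trans e e′ y = e′ y ⇔-∘ e y

  singleton-unique : {B : 𝒫 Y} {b₀ b b′ : Y} → B ≐ ｛ b₀ ｝ → B b → B b′ → b ≡ b′
  singleton-unique e Bb Bb′ = trans (to (e _) Bb) (sym (to (e _) Bb′))

  Id-≐-｛｝ : (a : Y) → Id Y a ≐ ｛ a ｝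
  Id-≐-｛｝ a y = mk⇔ sym sym

module _ {Y Z : Set} where

  ⋃ : 𝒫 Y → (Y → 𝒫 Z) → 𝒫 Z
  ⋃ B f c = ∃ λ b → B b × f b c

  ⋃-cong : {B B′ : 𝒫 Y} {f g : Y → 𝒫 Z}
         → B ≐ B′ → (∀ b → B b → f b ≐ g b) → ⋃ B f ≐ ⋃ B′ g
  ⋃-cong eB ef c = mk⇔
    (λ (b , Bb , fbc) → b , to (eB b) Bb , to (ef b Bb c) fbc)
    (λ (b , B′b , gbc) → let Bb = from (eB b) B′b in b , Bb , from (ef b Bb c) gbc)

  ⋃-singleton : {B : 𝒫 Y} {b : Y} {f : Y → 𝒫 Z} → B ≐ ｛ b ｝ → ⋃ B f ≐ f b
  ⋃-singleton {b = b} {f} e c = mk⇔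
    (λ (b′ , Bb′ , fb′c) → subst (λ y → f y c) (to (e b′) Bb′) fb′c)
    (λ fbc → b , from (e b) refl , fbc)

⇒-antisym : {X Y : Set} {ℓ₁ ℓ₂ : Level} {P : Rel X Y ℓ₁} {Q : Rel X Y ℓ₂}
          → P ⇒ Q → Q ⇒ P → P ≡ᴿ Q
⇒-antisym P⇒Q Q⇒P a b = mk⇔ P⇒Q Q⇒P

module _ {X Y Z : Set} where

  Λ-⨾ : (R : Rel X Y _) (S : Rel Y Z _) → Λ (R ⨾ S) ≡ᴹ (Λ R ∗ Λ S)
  Λ-⨾ R S a C = mk⇔
    (λ (lift e) → R a , lift ≐-refl , S , (λ _ _ → lift ≐-refl) , e)
    (λ (B , lift eB , f , hf , eC) →
       lift (≐-trans eC (⋃-cong eB (λ b Bb → lower (hf b Bb)))))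

  η-⨾ : (R : Rel X Y _) (S : Rel Y Z _) → η (R ⨾ S) ≡ᴹ (η R ∗ η S)
  η-⨾ R S a C = mk⇔ decompose compose
    where
    decompose : η (R ⨾ S) a C → (η R ∗ η S) a C
    decompose (lift (c , (b , r , s) , e)) =
      ｛ b ｝ , lift (b , r , ≐-refl) , (λ _ → ｛ c ｝) , (λ { _ refl → lift (c , s , ≐-refl) }) ,
      ≐-trans e (≐-sym (⋃-singleton ≐-refl))
    compose : (η R ∗ η S) a C → η (R ⨾ S) a C
    compose (B , lift (b , r , eB) , f , hf , eC) with hf b (from (eB b) refl)
    ... | lift (c , s , ef) = lift (c , (b , r , s) , ≐-trans eC (≐-trans (⋃-singleton eB) ef))

  α-∗⇒⨾ : (R : MRel X Y) (S : MRel Y Z) → α (R ∗ S) ⇒ (α R ⨾ α S)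
  α-∗⇒⨾ R S (C , (B , rB , f , hf , eC) , Cc) with to (eC _) Cc
  ... | b , Bb , fbc = b , (B , rB , Bb) , (f b , hf b Bb , fbc)

  α-⨾⇒∗-innerDetˡ : (R : MRel X Y) (S : MRel Y Z) → InnerDet R → (α R ⨾ α S) ⇒ α (R ∗ S)
  α-⨾⇒∗-innerDetˡ R S detR {a} (b , (B , rB , Bb) , (D , sD , Dc)) with detR a B rB
  ... | _ , eB = ⋃ B (λ _ → D) , (B , rB , (λ _ → D) , sameImage , ≐-refl) , (b , Bb , Dc)
    where
    sameImage : ∀ b′ → B b′ → S b′ D
    sameImage b′ Bb′ = subst (λ y → S y D) (singleton-unique eB Bb Bb′) sD

  α-⨾⇒∗-outerDetʳ : (R : MRel X Y) (S : MRel Y Z) → OuterDet S → (α R ⨾ α S) ⇒ α (R ∗ S)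
  α-⨾⇒∗-outerDetʳ R S (g , graph) (b , (B , rB , Bb) , (D , sD , Dc)) =
    ⋃ B g , (B , rB , g , (λ b′ _ → from (graph b′ (g b′)) ≐-refl) , ≐-refl) ,
    (b , Bb , to (to (graph b D) sD _) Dc)

  α-∗ : (R : MRel X Y) (S : MRel Y Z)
      → ((InnerDet R × InnerDet S) ⊎ (OuterDet R × OuterDet S))
      → α (R ∗ S) ≡ᴿ (α R ⨾ α S)
  α-∗ R S = [ (λ (detR , _) → ⇒-antisym (α-∗⇒⨾ R S) (α-⨾⇒∗-innerDetˡ R S detR))
            , (λ (_ , detS) → ⇒-antisym (α-∗⇒⨾ R S) (α-⨾⇒∗-outerDetʳ R S detS)) ]

module _ {X : Set} where

  Λ-Id : Λ (Id X) ≡ᴹ 𝟙 X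
  Λ-Id a B = mk⇔
    (λ (lift e) → lift (≐-trans e (Id-≐-｛｝ a)))
    (λ (lift e) → lift (≐-trans e (≐-sym (Id-≐-｛｝ a))))

  η-Id : η (Id X) ≡ᴹ 𝟙 X
  η-Id a B = mk⇔ (λ { (lift (_ , refl , e)) → lift e }) (λ (lift e) → lift (a , refl , e))

  α-𝟙 : α (𝟙 X) ≡ᴿ Id X
  α-𝟙 a b = mk⇔ (λ (B , lift e , Bb) → sym (to (e b) Bb))
                (λ { refl → ｛ a ｝ , lift ≐-refl , refl })

lemma3p4 : {X Y Z : Set}
    → ((R : Rel X Y _) (S : Rel Y Z _) → Λ (R ⨾ S) ≡ᴹ (Λ R ∗ Λ S))
    × (Λ (Id X) ≡ᴹ 𝟙 X)
    × ((R : Rel X Y _) (S : Rel Y Z _) → η (R ⨾ S) ≡ᴹ (η R ∗ η S))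
    × (η (Id X) ≡ᴹ 𝟙 X)
    × ((R : MRel X Y) (S : MRel Y Z)
        → ((InnerDet R × InnerDet S) ⊎ (OuterDet R × OuterDet S))
        → α (R ∗ S) ≡ᴿ (α R ⨾ α S))
    × (α (𝟙 X) ≡ᴿ Id X)
lemma3p4 = Λ-⨾ , Λ-Id , η-⨾ , η-Id , α-∗ , α-𝟙
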